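{- Let $r\ge1$ and $u_1,\dots,u_r\in S_{\mathbb{N}}$. Then in $(\mathcal{H},*)$, $$(u_1,u_2,\dots,u_r)+\sum_{i=1}^{r}(-1)^{i}\sum_{\bullet_2,\dots,\bullet_i}(u_i\bullet_i\cdots\bullet_2u_1)*(u_{i+1},\dots,u_r)=0,$$ where the inner sum is over all choices $\bullet_k\in\{\text{comma},+\}$, $2\le k\le i$ (the term $i=1$ is $-(u_1)*(u_2,\dots,u_r)$), and $(u_{r+1},\dots,u_r)$ is the empty word $1$.
   Context: Let $s_1,s_2,\dots$ be formal symbols and $S_{\mathbb{N}}$ the commutative semigroup of formal sums $\sum_i a_is_i$ ($a_i\in\mathbb{N}_0$, finitely many nonzero, not all zero). Words are finite sequences of elements of $S_{\mathbb{N}}$, including the empty word $1$; $\mathcal{H}$ is the $\mathbb{Q}$-vector space with basis the words. For $x=\sum c_\alpha\alpha$ and $u\in S_{\mathbb{N}}$, $(\{x\},u):=\sum c_\alpha(\alpha,u)$. The harmonic product $*$ is the $\mathbb{Q}$-bilinear map with $\mathbf{w}*1=1*\mathbf{w}=\mathbf{w}$ and $(\mathbf{w}_1,u_1)*(\mathbf{w}_2,u_2)=(\{\mathbf{w}_1*(\mathbf{w}_2,u_2)\},u_1)+(\{(\mathbf{w}_1,u_1)*\mathbf{w}_2\},u_2)+(\{\mathbf{w}_1*\mathbf{w}_2\},u_1+u_2)$. $(u_i\bullet_i\cdots\bullet_2u_1)$ denotes the word obtained by listing $u_i,\dots,u_1$ in this order and, between consecutive $u_k,u_{k-1}$, either separating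 them ($\bullet_k$ = comma) or adding them into one letter ($\bullet_k=+$). -}

module Defs where

open import Data.Nat as ℕ using (ℕ; zero; suc)
open import Data.List using (List; []; _∷_; _++_; map; concatMap; reverse; take; drop; length; upTo)
open import Data.Product using (_×_; _,_; proj₁; proj₂)
open import Data.Rational as ℚ using (ℚ; 0ℚ; 1ℚ; -_)
import Data.List.Properties as LP
import Data.Product.Properties as PP
open import Relation.Nullary using (yes; no)
open import Relation.Binary.Definitions using (DecidableEquality)

-- A letter (xs , k) represents the formal sum  Σ a_i s_i  with coefficient
-- list  a_1,...,a_n = xs ++ [ suc k ]  (the last coefficient is nonzero).
-- This is a bijective (canonical) encoding of the nonzero, finitely
-- supported sums Σ a_i s_i, a_i ∈ ℕ₀.

Letter : Set
Letter = List ℕ × ℕ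

addRep : List ℕ → ℕ → List ℕ → ℕ → List ℕ × ℕ
addRep []       k []       m = [] , suc (k ℕ.+ m)
addRep []       k (y ∷ ys) m = (suc k ℕ.+ y) ∷ ys , m
addRep (x ∷ xs) k []       m = (x ℕ.+ suc m) ∷ xs , k
addRep (x ∷ xs) k (y ∷ ys) m with addRep xs k ys m
... | zs , l = (x ℕ.+ y) ∷ zs , l

_⊕_ : Letter → Letter → Letter
(xs , k) ⊕ (ys , m) = addRep xs k ys m

_≟L_ : DecidableEquality Letter
_≟L_ = PP.≡-dec (LP.≡-dec ℕ._≟_) ℕ._≟_

-- Words (u_1,...,u_n) are lists written in the natural left-to-right order;
-- the empty list is the empty word 1.

Word : Set
Word = List Letter

_≟W_ : DecidableEquality Word
_≟W_ = LP.≡-dec _≟L_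

ℋ : Set
ℋ = List (ℚ × Word)

-- coefficient of a word in an element of ℋ (equality in ℋ is
-- equality of all coefficients)
coeff : Word → ℋ → ℚ
coeff w [] = 0ℚ
coeff w ((c , α) ∷ x) with α ≟W w
... | yes _ = c ℚ.+ coeff w x
... | no  _ = coeff w x

scale : ℚ → ℋ → ℋ
scale c = map (λ p → (c ℚ.* proj₁ p , proj₂ p))

mapWords : (Word → Word) → ℋ → ℋ
mapWords f = map (λ p → (proj₁ p , f (proj₂ p)))

-- Harmonic product.  The defining recursion peels off the LAST letters,
-- so we first run it on reversed words (head = last letter):
-- here  u ∷ w  stands for the word (w , u).

revHarm : Word → Word → ℋ
revHarm [] w = (1ℚ , w) ∷ []
revHarm (u₁ ∷ w₁) [] = (1ℚ , u₁ ∷ w₁) ∷ []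
revHarm (u₁ ∷ w₁) (u₂ ∷ w₂) =
     mapWords (u₁ ∷_) (revHarm w₁ (u₂ ∷ w₂))
  ++ mapWords (u₂ ∷_) (revHarm (u₁ ∷ w₁) w₂)
  ++ mapWords ((u₁ ⊕ u₂) ∷_) (revHarm w₁ w₂)

_*w_ : Word → Word → ℋ
w₁ *w w₂ = mapWords reverse (revHarm (reverse w₁) (reverse w₂))

_*_ : ℋ → ℋ → ℋ
x * y = concatMap (λ p → concatMap (λ q →
          scale (proj₁ p ℚ.* proj₁ q) (proj₂ p *w proj₂ q)) y) x

-- All words (v₁ • v₂ • ... • vₙ) obtained from a list v₁,...,vₙ (n ≥ 1)
-- by choosing each • ∈ {comma, +}.  One word per choice (2^(n-1) words,
-- listed with multiplicity).

bullets : List Letter → List Word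
bullets [] = []
bullets (x ∷ []) = (x ∷ []) ∷ []
bullets (x ∷ y ∷ rest) = concatMap choose (bullets (y ∷ rest))
  where
  choose : Word → List Word
  choose [] = []
  choose (v ∷ w) = (x ∷ v ∷ w) ∷ ((x ⊕ v) ∷ w) ∷ []

sign : ℕ → ℚ
sign zero = 1ℚ
sign (suc i) = - sign i

term : List Letter → ℕ → ℋ
term us i = ((map (λ β → (1ℚ , β)) (bullets (reverse (take i us)))))
            * ((1ℚ , drop i us) ∷ [])

lhs : List Letter → ℋ
lhs us = (1ℚ , us) ∷
  concatMap (λ j → scale (sign (suc j)) (term us (suc j))) (upTo (length us))

-- The harmonic product * peels off last letters; the product ⋆ that peels off first
-- letters agrees with it, because ⋆ also satisfies the last-letter recursion.
-- With the first-letter recursion, for a word (a, u) one has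
--   (a, u) ⋆ (b, v) = (a, u ⋆ (b, v)) + [ (b, (a, u) ⋆ v) + (a + b, u ⋆ v) ],
-- and the bracket consists of the terms starting with the first letter of the two words
-- (b, a, u) and (b + a, u) obtained by prepending b with a comma or a plus.  So if L_i
-- collects the terms of the i-th summand that start with the first letter of
-- (u_i • ⋯ • u_1), the i-th summand is L_i + L_{i+1} (and just L_r for i = r); the
-- alternating sum telescopes to -L_1 = -(u_1, …, u_r).
module Submission where

open import Defs
open import Algebra.Bundles using (CommutativeMonoid)
open import Algebra.Structures using (IsCommutativeMonoid)
import Algebra.Solver.CommutativeMonoid as CommutativeMonoidSolver
open import Data.List using (List; []; _∷_; _++_; map; concatMap; take; drop; reverse; _∷ʳ_; length; upTo)
import Data.List.Properties as List
open import Data.List.Relation.Unary.All using (All; []; _∷_)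
open import Data.Nat using (ℕ; suc; _≤_)
import Data.Nat.Properties as ℕ
open import Data.Product using (_,_; proj₁; proj₂)
open import Data.Rational using (ℚ; 0ℚ; 1ℚ; _+_; -_) renaming (_*_ to _·_)
import Data.Rational.Properties as ℚ
open import Algebra.Properties.Group ℚ.+-0-group using (//-rightDividesʳ)
open import Function using (_∘_; id)
open import Relation.Nullary using (yes; no; contradiction)
open import Relation.Binary.PropositionalEquality
  using (_≡_; _≢_; refl; sym; trans; cong; cong₂; subst; module ≡-Reasoning)
import Relation.Binary.Reasoning.Setoid as SetoidReasoning

addRep-comm : ∀ xs k ys m → addRep xs k ys m ≡ addRep ys m xs k
addRep-comm []       k []       m = cong (λ n → [] , suc n) (ℕ.+-comm k m)
addRep-comm []       k (y ∷ ys) m = cong (λ z → z ∷ ys , m) (ℕ.+-comm (suc k) y)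
addRep-comm (x ∷ xs) k []       m = cong (λ z → z ∷ xs , k) (ℕ.+-comm x (suc m))
addRep-comm (x ∷ xs) k (y ∷ ys) m
  with addRep xs k ys m | addRep ys m xs k | addRep-comm xs k ys m
... | zs , l | .(zs , l) | refl = cong (λ z → z ∷ zs , l) (ℕ.+-comm x y)

⊕-comm : ∀ a b → a ⊕ b ≡ b ⊕ a
⊕-comm (xs , k) (ys , m) = addRep-comm xs k ys m

coeff-++ : ∀ w x y → coeff w (x ++ y) ≡ coeff w x + coeff w y
coeff-++ w []            y = sym (ℚ.+-identityˡ (coeff w y))
coeff-++ w ((c , α) ∷ x) y with α ≟W w
... | yes _ = trans (cong (c +_) (coeff-++ w x y)) (sym (ℚ.+-assoc c (coeff w x) (coeff w y)))
... | no  _ = coeff-++ w x y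

-- A record rather than a function type, so that Agda can infer x and y from x ≈ y.
infix 4 _≈_
record _≈_ (x y : ℋ) : Set where
  constructor by-coeff
  field coeff-≡ : ∀ w → coeff w x ≡ coeff w y
open _≈_

++-isCommutativeMonoid : IsCommutativeMonoid _≈_ _++_ []
++-isCommutativeMonoid = record
  { isMonoid = record
    { isSemigroup = record
      { isMagma = record
        { isEquivalence = record
          { refl  = by-coeff λ w → refl
          ; sym   = λ p → by-coeff λ w → sym (p .coeff-≡ w)
          ; trans = λ p q → by-coeff λ w → trans (p .coeff-≡ w) (q .coeff-≡ w)
          }
        ; ∙-cong = λ {x} {x′} {y} {y′} p q → by-coeff λ w → begin
            coeff w (x ++ y)          ≡⟨ coeff-++ w x y ⟩
            coeff w x + coeff w y     ≡⟨ cong₂ _+_ (p .coeff-≡ w) (q .coeff-≡ w) ⟩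
            coeff w x′ + coeff w y′   ≡⟨ coeff-++ w x′ y′ ⟨
            coeff w (x′ ++ y′)        ∎
        }
      ; assoc = λ x y z → ≡⇒≈ (List.++-assoc x y z)
      }
    ; identity = (λ x → ≡⇒≈ refl) , (λ x → ≡⇒≈ (List.++-identityʳ x))
    }
  ; comm = λ x y → by-coeff λ w → begin
      coeff w (x ++ y)          ≡⟨ coeff-++ w x y ⟩
      coeff w x + coeff w y     ≡⟨ ℚ.+-comm (coeff w x) (coeff w y) ⟩
      coeff w y + coeff w x     ≡⟨ coeff-++ w y x ⟨
      coeff w (y ++ x)          ∎
  }
  where
  open ≡-Reasoning
  ≡⇒≈ : ∀ {x y} → x ≡ y → x ≈ y
  ≡⇒≈ x≡y = by-coeff λ w → cong (coeff w) x≡y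

++-commutativeMonoid : CommutativeMonoid _ _
++-commutativeMonoid = record { isCommutativeMonoid = ++-isCommutativeMonoid }

open CommutativeMonoid ++-commutativeMonoid
  using (∙-cong; ∙-congˡ; ∙-congʳ)
  renaming (setoid to ℋ-setoid; reflexive to ≡⇒≈; refl to ≈-refl; trans to ≈-trans)
open import Algebra.Properties.CommutativeSemigroup (CommutativeMonoid.commutativeSemigroup ++-commutativeMonoid)
  using (interchange; x∙yz≈y∙xz)
open CommutativeMonoidSolver ++-commutativeMonoid using (solve; _⊜_) renaming (_⊕_ to _⊞_)

++-transpose₃ : ∀ a₁ a₂ a₃ b₁ b₂ b₃ c₁ c₂ c₃ →
  (a₁ ++ a₂ ++ a₃) ++ (b₁ ++ b₂ ++ b₃) ++ (c₁ ++ c₂ ++ c₃) ≈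
  (a₁ ++ b₁ ++ c₁) ++ (a₂ ++ b₂ ++ c₂) ++ (a₃ ++ b₃ ++ c₃)
++-transpose₃ = solve 9 (λ a₁ a₂ a₃ b₁ b₂ b₃ c₁ c₂ c₃ →
  (a₁ ⊞ a₂ ⊞ a₃) ⊞ (b₁ ⊞ b₂ ⊞ b₃) ⊞ (c₁ ⊞ c₂ ⊞ c₃) ⊜
  (a₁ ⊞ b₁ ⊞ c₁) ⊞ (a₂ ⊞ b₂ ⊞ c₂) ⊞ (a₃ ⊞ b₃ ⊞ c₃)) (by-coeff λ w → refl)

module _ (f g : Word → Word) (g∘f≗id : ∀ v → g (f v) ≡ v) where

  coeff-mapWords-image : ∀ w → f (g w) ≡ w → ∀ x → coeff w (mapWords f x) ≡ coeff (g w) x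
  coeff-mapWords-image w fg≡w [] = refl
  coeff-mapWords-image w fg≡w ((c , α) ∷ x) with f α ≟W w | α ≟W g w
  ... | yes _    | yes _    = cong (c +_) (coeff-mapWords-image w fg≡w x)
  ... | no _     | no _     = coeff-mapWords-image w fg≡w x
  ... | yes fα≡w | no α≢gw  = contradiction (trans (sym (g∘f≗id α)) (cong g fα≡w)) α≢gw
  ... | no fα≢w  | yes α≡gw = contradiction (trans (cong f α≡gw) fg≡w) fα≢w

  coeff-mapWords-nonimage : ∀ w → f (g w) ≢ w → ∀ x → coeff w (mapWords f x) ≡ 0ℚ
  coeff-mapWords-nonimage w fg≢w [] = refl
  coeff-mapWords-nonimage w fg≢w ((c , α) ∷ x) with f α ≟W w
  ... | yes fα≡w = contradiction (subst (λ v → f (g v) ≡ v) fα≡w (cong f (g∘f≗id α))) fg≢w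
  ... | no _     = coeff-mapWords-nonimage w fg≢w x

  mapWords-cong : ∀ {x y} → x ≈ y → mapWords f x ≈ mapWords f y
  mapWords-cong {x} {y} x≈y = by-coeff coeff-≡-mapWords
    where
    coeff-≡-mapWords : ∀ w → coeff w (mapWords f x) ≡ coeff w (mapWords f y)
    coeff-≡-mapWords w with f (g w) ≟W w
    ... | yes fg≡w = trans (coeff-mapWords-image w fg≡w x)
                       (trans (x≈y .coeff-≡ (g w)) (sym (coeff-mapWords-image w fg≡w y)))
    ... | no fg≢w  = trans (coeff-mapWords-nonimage w fg≢w x) (sym (coeff-mapWords-nonimage w fg≢w y))

mapWords-++₃ : ∀ (f : Word → Word) x y z →
  mapWords f (x ++ y ++ z) ≡ mapWords f x ++ mapWords f y ++ mapWords f z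
mapWords-++₃ f x y z = trans (List.map-++ _ x (y ++ z)) (cong (mapWords f x ++_) (List.map-++ _ y z))

mapWords-∘ : ∀ (f g : Word → Word) x → mapWords f (mapWords g x) ≡ mapWords (f ∘ g) x
mapWords-∘ f g x = sym (List.map-∘ x)

mapWords-≗ : ∀ {f g : Word → Word} → (∀ v → f v ≡ g v) → ∀ x → mapWords f x ≡ mapWords g x
mapWords-≗ f≗g = List.map-cong λ p → cong (proj₁ p ,_) (f≗g (proj₂ p))

infixr 6 _▸_
_▸_ : Letter → ℋ → ℋ
a ▸ x = mapWords (a ∷_) x

infixl 6 _◂_
_◂_ : ℋ → Letter → ℋ
x ◂ a = mapWords (_∷ʳ a) x

▸-cong : ∀ a {x y} → x ≈ y → a ▸ x ≈ a ▸ y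
▸-cong a {x} {y} = mapWords-cong (a ∷_) (drop 1) (λ v → refl) {x} {y}

◂-cong : ∀ a {x y} → x ≈ y → x ◂ a ≈ y ◂ a
◂-cong a {x} {y} = mapWords-cong (_∷ʳ a) (reverse ∘ drop 1 ∘ reverse) dropLast∘∷ʳ≗id {x} {y}
  where
  dropLast∘∷ʳ≗id : ∀ v → reverse (drop 1 (reverse (v ∷ʳ a))) ≡ v
  dropLast∘∷ʳ≗id v = trans (cong (reverse ∘ drop 1) (List.reverse-++ v (a ∷ []))) (List.reverse-involutive v)

▸-++₃ : ∀ a x y z → a ▸ (x ++ y ++ z) ≡ a ▸ x ++ a ▸ y ++ a ▸ z
▸-++₃ a = mapWords-++₃ (a ∷_)

▸-◂ : ∀ a x b → a ▸ (x ◂ b) ≡ (a ▸ x) ◂ b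
▸-◂ a x b = trans (mapWords-∘ (a ∷_) (_∷ʳ b) x) (sym (mapWords-∘ (_∷ʳ b) (a ∷_) x))

◂-▸₃ : ∀ x A y B z C a → (x ▸ A ++ y ▸ B ++ z ▸ C) ◂ a ≡ x ▸ (A ◂ a) ++ y ▸ (B ◂ a) ++ z ▸ (C ◂ a)
◂-▸₃ x A y B z C a = trans (mapWords-++₃ (_∷ʳ a) (x ▸ A) (y ▸ B) (z ▸ C))
  (sym (cong₂ _++_ (▸-◂ x A a) (cong₂ _++_ (▸-◂ y B a) (▸-◂ z C a))))

reverse-▸ : ∀ a x → mapWords reverse (a ▸ x) ≡ mapWords reverse x ◂ a
reverse-▸ a x = begin
  mapWords reverse (a ▸ x)          ≡⟨ mapWords-∘ reverse (a ∷_) x ⟩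
  mapWords (reverse ∘ (a ∷_)) x     ≡⟨ mapWords-≗ (List.unfold-reverse a) x ⟩
  mapWords ((_∷ʳ a) ∘ reverse) x    ≡⟨ mapWords-∘ (_∷ʳ a) reverse x ⟨
  mapWords reverse x ◂ a            ∎
  where open ≡-Reasoning

▸◂-transpose : ∀ x y z a b c A₁ A₂ A₃ B₁ B₂ B₃ C₁ C₂ C₃ →
     x ▸ (A₁ ◂ a ++ A₂ ◂ b ++ A₃ ◂ c)
  ++ y ▸ (B₁ ◂ a ++ B₂ ◂ b ++ B₃ ◂ c)
  ++ z ▸ (C₁ ◂ a ++ C₂ ◂ b ++ C₃ ◂ c)
  ≈  (x ▸ A₁ ++ y ▸ B₁ ++ z ▸ C₁) ◂ a
  ++ (x ▸ A₂ ++ y ▸ B₂ ++ z ▸ C₂) ◂ b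
  ++ (x ▸ A₃ ++ y ▸ B₃ ++ z ▸ C₃) ◂ c
▸◂-transpose x y z a b c A₁ A₂ A₃ B₁ B₂ B₃ C₁ C₂ C₃ = begin
     x ▸ (A₁ ◂ a ++ A₂ ◂ b ++ A₃ ◂ c)
  ++ y ▸ (B₁ ◂ a ++ B₂ ◂ b ++ B₃ ◂ c)
  ++ z ▸ (C₁ ◂ a ++ C₂ ◂ b ++ C₃ ◂ c)
    ≡⟨ cong₂ _++_ (▸-++₃ x (A₁ ◂ a) (A₂ ◂ b) (A₃ ◂ c))
         (cong₂ _++_ (▸-++₃ y (B₁ ◂ a) (B₂ ◂ b) (B₃ ◂ c)) (▸-++₃ z (C₁ ◂ a) (C₂ ◂ b) (C₃ ◂ c))) ⟩
     (x ▸ (A₁ ◂ a) ++ x ▸ (A₂ ◂ b) ++ x ▸ (A₃ ◂ c))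
  ++ (y ▸ (B₁ ◂ a) ++ y ▸ (B₂ ◂ b) ++ y ▸ (B₃ ◂ c))
  ++ (z ▸ (C₁ ◂ a) ++ z ▸ (C₂ ◂ b) ++ z ▸ (C₃ ◂ c))
    ≈⟨ ++-transpose₃ (x ▸ (A₁ ◂ a)) (x ▸ (A₂ ◂ b)) (x ▸ (A₃ ◂ c))
                     (y ▸ (B₁ ◂ a)) (y ▸ (B₂ ◂ b)) (y ▸ (B₃ ◂ c))
                     (z ▸ (C₁ ◂ a)) (z ▸ (C₂ ◂ b)) (z ▸ (C₃ ◂ c)) ⟩
     (x ▸ (A₁ ◂ a) ++ y ▸ (B₁ ◂ a) ++ z ▸ (C₁ ◂ a))
  ++ (x ▸ (A₂ ◂ b) ++ y ▸ (B₂ ◂ b) ++ z ▸ (C₂ ◂ b))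
  ++ (x ▸ (A₃ ◂ c) ++ y ▸ (B₃ ◂ c) ++ z ▸ (C₃ ◂ c))
    ≡⟨ cong₂ _++_ (◂-▸₃ x A₁ y B₁ z C₁ a) (cong₂ _++_ (◂-▸₃ x A₂ y B₂ z C₂ b) (◂-▸₃ x A₃ y B₃ z C₃ c)) ⟨
     (x ▸ A₁ ++ y ▸ B₁ ++ z ▸ C₁) ◂ a
  ++ (x ▸ A₂ ++ y ▸ B₂ ++ z ▸ C₂) ◂ b
  ++ (x ▸ A₃ ++ y ▸ B₃ ++ z ▸ C₃) ◂ c ∎
  where open SetoidReasoning ℋ-setoid

infix 7 _⋆_
_⋆_ : Word → Word → ℋ
[]      ⋆ v       = (1ℚ , v) ∷ []
(a ∷ u) ⋆ []      = (1ℚ , a ∷ u) ∷ []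
(a ∷ u) ⋆ (b ∷ v) = a ▸ u ⋆ (b ∷ v) ++ b ▸ (a ∷ u) ⋆ v ++ (a ⊕ b) ▸ u ⋆ v

⋆-identityʳ : ∀ u → u ⋆ [] ≡ (1ℚ , u) ∷ []
⋆-identityʳ []      = refl
⋆-identityʳ (a ∷ u) = refl

-- Both sides expand into the nine terms x ▸ A ◂ c, grouped by first letter on the left and
-- by last letter on the right; in the boundary cases the missing terms are [].
⋆-∷ʳ : ∀ u a v b →
  (u ∷ʳ a) ⋆ (v ∷ʳ b) ≈ u ⋆ (v ∷ʳ b) ◂ a ++ (u ∷ʳ a) ⋆ v ◂ b ++ u ⋆ v ◂ (a ⊕ b)
⋆-∷ʳ [] a [] b = x∙yz≈y∙xz ((1ℚ , a ∷ b ∷ []) ∷ []) ((1ℚ , b ∷ a ∷ []) ∷ []) ((1ℚ , (a ⊕ b) ∷ []) ∷ [])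
⋆-∷ʳ [] a (y ∷ v) b =
  ≈-trans (∙-congˡ {a ▸ [] ⋆ (y ∷ v ∷ʳ b)} (∙-congʳ {(a ⊕ y) ▸ [] ⋆ (v ∷ʳ b)} (▸-cong y (⋆-∷ʳ [] a v b))))
    (▸◂-transpose a y (a ⊕ y) a b (a ⊕ b)
      [] ((1ℚ , y ∷ v) ∷ []) [] ([] ⋆ (v ∷ʳ b)) ((a ∷ []) ⋆ v) ([] ⋆ v) [] ((1ℚ , v) ∷ []) [])
⋆-∷ʳ (x ∷ u) a [] b =
  ≈-trans (∙-cong (▸-cong x (⋆-∷ʳ u a [] b))
                  (∙-congˡ {b ▸ (x ∷ u ∷ʳ a) ⋆ []} (▸-cong (x ⊕ b)
                    (≡⇒≈ (trans (⋆-identityʳ (u ∷ʳ a)) (cong (λ t → t ◂ a ++ []) (sym (⋆-identityʳ u))))))))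
  (≈-trans (▸◂-transpose x b (x ⊕ b) a b (a ⊕ b)
             (u ⋆ (b ∷ [])) ((u ∷ʳ a) ⋆ []) (u ⋆ []) ((1ℚ , x ∷ u) ∷ []) [] [] (u ⋆ []) [] [])
           (≡⇒≈ (cong₂ (λ s t → (x ∷ u) ⋆ (b ∷ []) ◂ a ++ s ◂ b ++ t ◂ (a ⊕ b)) (▸⋆[] (u ∷ʳ a)) (▸⋆[] u))))
  where
  ▸⋆[] : ∀ u → x ▸ u ⋆ [] ++ [] ≡ (x ∷ u) ⋆ []
  ▸⋆[] u = trans (List.++-identityʳ (x ▸ u ⋆ [])) (cong (x ▸_) (⋆-identityʳ u))
⋆-∷ʳ (x ∷ u) a (y ∷ v) b =
  ≈-trans (∙-cong (▸-cong x (⋆-∷ʳ u a (y ∷ v) b))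
                  (∙-cong (▸-cong y (⋆-∷ʳ (x ∷ u) a v b)) (▸-cong (x ⊕ y) (⋆-∷ʳ u a v b))))
    (▸◂-transpose x y (x ⊕ y) a b (a ⊕ b)
      (u ⋆ (y ∷ v ∷ʳ b)) ((u ∷ʳ a) ⋆ (y ∷ v)) (u ⋆ (y ∷ v))
      ((x ∷ u) ⋆ (v ∷ʳ b)) ((x ∷ u ∷ʳ a) ⋆ v) ((x ∷ u) ⋆ v)
      (u ⋆ (v ∷ʳ b)) ((u ∷ʳ a) ⋆ v) (u ⋆ v))

reverse-revHarm : ∀ u v → mapWords reverse (revHarm u v) ≈ reverse u ⋆ reverse v
reverse-revHarm []      v  = ≈-refl
reverse-revHarm (a ∷ u) [] = ≡⇒≈ (sym (⋆-identityʳ (reverse (a ∷ u))))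
reverse-revHarm (a ∷ u) (b ∷ v) = begin
  mapWords reverse (a ▸ revHarm u (b ∷ v) ++ b ▸ revHarm (a ∷ u) v ++ (a ⊕ b) ▸ revHarm u v)
    ≡⟨ trans (mapWords-++₃ reverse (a ▸ revHarm u (b ∷ v)) (b ▸ revHarm (a ∷ u) v) ((a ⊕ b) ▸ revHarm u v))
             (cong₂ _++_ (reverse-▸ a (revHarm u (b ∷ v)))
               (cong₂ _++_ (reverse-▸ b (revHarm (a ∷ u) v)) (reverse-▸ (a ⊕ b) (revHarm u v)))) ⟩
     mapWords reverse (revHarm u (b ∷ v)) ◂ a
  ++ mapWords reverse (revHarm (a ∷ u) v) ◂ b
  ++ mapWords reverse (revHarm u v) ◂ (a ⊕ b)
    ≈⟨ ∙-cong (◂-cong a (reverse-revHarm u (b ∷ v)))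
         (∙-cong (◂-cong b (reverse-revHarm (a ∷ u) v)) (◂-cong (a ⊕ b) (reverse-revHarm u v))) ⟩
  reverse u ⋆ reverse (b ∷ v) ◂ a ++ reverse (a ∷ u) ⋆ reverse v ◂ b ++ reverse u ⋆ reverse v ◂ (a ⊕ b)
    ≡⟨ cong₂ (λ s t → reverse u ⋆ s ◂ a ++ t ⋆ reverse v ◂ b ++ reverse u ⋆ reverse v ◂ (a ⊕ b))
         (List.unfold-reverse b v) (List.unfold-reverse a u) ⟩
  reverse u ⋆ (reverse v ∷ʳ b) ◂ a ++ (reverse u ∷ʳ a) ⋆ reverse v ◂ b ++ reverse u ⋆ reverse v ◂ (a ⊕ b)
    ≈⟨ ⋆-∷ʳ (reverse u) a (reverse v) b ⟨
  (reverse u ∷ʳ a) ⋆ (reverse v ∷ʳ b)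
    ≡⟨ cong₂ _⋆_ (List.unfold-reverse a u) (List.unfold-reverse b v) ⟨
  reverse (a ∷ u) ⋆ reverse (b ∷ v) ∎
  where open SetoidReasoning ℋ-setoid

*w≈⋆ : ∀ u v → u *w v ≈ u ⋆ v
*w≈⋆ u v = ≈-trans (reverse-revHarm (reverse u) (reverse v))
  (≡⇒≈ (cong₂ _⋆_ (List.reverse-involutive u) (List.reverse-involutive v)))

coeff-scale : ∀ w c x → coeff w (scale c x) ≡ c · coeff w x
coeff-scale w c []            = sym (ℚ.*-zeroʳ c)
coeff-scale w c ((d , α) ∷ x) with α ≟W w
... | yes _ = trans (cong (c · d +_) (coeff-scale w c x)) (sym (ℚ.*-distribˡ-+ c d (coeff w x)))
... | no  _ = coeff-scale w c x

scale-cong : ∀ c {x y} → x ≈ y → scale c x ≈ scale c y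
scale-cong c {x} {y} x≈y = by-coeff λ w →
  trans (coeff-scale w c x) (trans (cong (c ·_) (x≈y .coeff-≡ w)) (sym (coeff-scale w c y)))

scale-identityˡ : ∀ x → scale 1ℚ x ≈ x
scale-identityˡ x = by-coeff λ w → trans (coeff-scale w 1ℚ x) (ℚ.*-identityˡ (coeff w x))

coeff-scale-neg : ∀ w c x → coeff w (scale (- c) x) ≡ - coeff w (scale c x)
coeff-scale-neg w c x = trans (coeff-scale w (- c) x)
  (trans (sym (ℚ.neg-distribˡ-* c (coeff w x))) (cong -_ (sym (coeff-scale w c x))))

infix 7 _⊛_
_⊛_ : List Word → Word → ℋ
X ⊛ v = concatMap (_⋆ v) X

*-word≈⊛ : ∀ B v → map (λ β → (1ℚ , β)) B * ((1ℚ , v) ∷ []) ≈ B ⊛ v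
*-word≈⊛ []      v = ≈-refl
*-word≈⊛ (β ∷ B) v =
  ∙-cong (≈-trans (≡⇒≈ (List.++-identityʳ _)) (≈-trans (scale-identityˡ (β *w v)) (*w≈⋆ β v)))
         (*-word≈⊛ B v)

data NonEmpty : Word → Set where
  nonEmpty : ∀ {a u} → NonEmpty (a ∷ u)

extend : Letter → Word → List Word
extend b []      = []
extend b (a ∷ u) = (b ∷ a ∷ u) ∷ ((b ⊕ a) ∷ u) ∷ []

bullets-∷ : ∀ b a u → bullets (b ∷ a ∷ u) ≡ concatMap (extend b) (bullets (a ∷ u))
bullets-∷ b a u = List.concatMap-cong (λ { [] → refl ; (_ ∷ _) → refl }) (bullets (a ∷ u))

extend-nonEmpty : ∀ b X → All NonEmpty (concatMap (extend b) X)
extend-nonEmpty b []            = []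
extend-nonEmpty b ([] ∷ X)      = extend-nonEmpty b X
extend-nonEmpty b ((a ∷ u) ∷ X) = nonEmpty ∷ nonEmpty ∷ extend-nonEmpty b X

bullets-nonEmpty : ∀ a u → All NonEmpty (bullets (a ∷ u))
bullets-nonEmpty a []      = nonEmpty ∷ []
bullets-nonEmpty a (b ∷ u) = subst (All NonEmpty) (sym (bullets-∷ a b u)) (extend-nonEmpty a (bullets (b ∷ u)))

lead : Word → Word → ℋ
lead []      v = []
lead (a ∷ u) v = a ▸ u ⋆ v

leading : List Word → Word → ℋ
leading X v = concatMap (λ β → lead β v) X

⋆-∷-lead : ∀ a u b v → (a ∷ u) ⋆ (b ∷ v) ≈ lead (a ∷ u) (b ∷ v) ++ leading (extend b (a ∷ u)) v
⋆-∷-lead a u b v = ≡⇒≈ (cong (λ z → a ▸ u ⋆ (b ∷ v) ++ b ▸ (a ∷ u) ⋆ v ++ z)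
  (trans (cong (λ c → c ▸ u ⋆ v) (⊕-comm a b)) (sym (List.++-identityʳ ((b ⊕ a) ▸ u ⋆ v)))))

⊛-∷ : ∀ {X} → All NonEmpty X → ∀ b v → X ⊛ (b ∷ v) ≈ leading X (b ∷ v) ++ leading (concatMap (extend b) X) v
⊛-∷ [] b v = ≈-refl
⊛-∷ {(a ∷ u) ∷ X} (nonEmpty ∷ neX) b v = begin
  (a ∷ u) ⋆ (b ∷ v) ++ X ⊛ (b ∷ v)
    ≈⟨ ∙-cong (⋆-∷-lead a u b v) (⊛-∷ neX b v) ⟩
  (lead (a ∷ u) (b ∷ v) ++ leading (extend b (a ∷ u)) v) ++ (leading X (b ∷ v) ++ leading X′ v)
    ≈⟨ interchange (lead (a ∷ u) (b ∷ v)) (leading (extend b (a ∷ u)) v) (leading X (b ∷ v)) (leading X′ v) ⟩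
  (lead (a ∷ u) (b ∷ v) ++ leading X (b ∷ v)) ++ (leading (extend b (a ∷ u)) v ++ leading X′ v)
    ≡⟨ cong (leading ((a ∷ u) ∷ X) (b ∷ v) ++_) (List.concatMap-++ (λ β → lead β v) (extend b (a ∷ u)) X′) ⟨
  leading ((a ∷ u) ∷ X) (b ∷ v) ++ leading (concatMap (extend b) ((a ∷ u) ∷ X)) v ∎
  where
  open SetoidReasoning ℋ-setoid
  X′ = concatMap (extend b) X

⊛-[] : ∀ {X} → All NonEmpty X → X ⊛ [] ≡ leading X []
⊛-[] [] = refl
⊛-[] {(a ∷ u) ∷ X} (nonEmpty ∷ neX) = cong₂ _++_ (cong (a ▸_) (sym (⋆-identityʳ u))) (⊛-[] neX)

concatMap-cong-≈ : ∀ {A : Set} {F G : A → ℋ} → (∀ j → F j ≈ G j) → ∀ js → concatMap F js ≈ concatMap G js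
concatMap-cong-≈ F≈G []       = ≈-refl
concatMap-cong-≈ F≈G (j ∷ js) = ∙-cong (F≈G j) (concatMap-cong-≈ F≈G js)

concatMap-upTo-suc : ∀ {A : Set} (F : ℕ → List A) n → concatMap F (upTo (suc n)) ≡ F 0 ++ concatMap (F ∘ suc) (upTo n)
concatMap-upTo-suc F n = cong (F 0 ++_) (trans (cong (concatMap F) (sym (List.map-applyUpTo id suc n)))
                                              (List.concatMap-map F suc (upTo n)))

coeff-concatMap-neg : ∀ w (s : ℕ → ℚ) (X : ℕ → ℋ) js →
  coeff w (concatMap (λ j → scale (- s j) (X j)) js) ≡ - coeff w (concatMap (λ j → scale (s j) (X j)) js)
coeff-concatMap-neg w s X []       = refl
coeff-concatMap-neg w s X (j ∷ js) = begin
  coeff w (scale (- s j) (X j) ++ concatMap (λ j → scale (- s j) (X j)) js)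
    ≡⟨ coeff-++ w (scale (- s j) (X j)) _ ⟩
  coeff w (scale (- s j) (X j)) + coeff w (concatMap (λ j → scale (- s j) (X j)) js)
    ≡⟨ cong₂ _+_ (coeff-scale-neg w (s j) (X j)) (coeff-concatMap-neg w s X js) ⟩
  - coeff w (scale (s j) (X j)) + - coeff w (concatMap (λ j → scale (s j) (X j)) js)
    ≡⟨ ℚ.neg-distrib-+ (coeff w (scale (s j) (X j))) _ ⟨
  - (coeff w (scale (s j) (X j)) + coeff w (concatMap (λ j → scale (s j) (X j)) js))
    ≡⟨ cong -_ (coeff-++ w (scale (s j) (X j)) _) ⟨
  - coeff w (scale (s j) (X j) ++ concatMap (λ j → scale (s j) (X j)) js) ∎
  where open ≡-Reasoning

-- With ρ = (u_k, …, u_1) and v = (u_{k+1}, …, u_r), alternatingSum ρ v is the part i > k of the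
-- sum in the theorem, multiplied by (-1)^k.
alternatingTerm : Word → Word → ℕ → ℋ
alternatingTerm ρ v j = scale (sign (suc j)) (bullets (reverse (take j v) ++ ρ) ⊛ drop j v)

alternatingSum : Word → Word → ℋ
alternatingSum ρ v = concatMap (alternatingTerm ρ v) (upTo (suc (length v)))

alternatingTerm-suc : ∀ ρ b v j →
  alternatingTerm ρ (b ∷ v) (suc j) ≡ scale (- sign (suc j)) (bullets (reverse (take j v) ++ b ∷ ρ) ⊛ drop j v)
alternatingTerm-suc ρ b v j = cong (λ σ → scale (- sign (suc j)) (bullets σ ⊛ drop j v))
  (trans (cong (_++ ρ) (List.unfold-reverse b (take j v))) (List.++-assoc (reverse (take j v)) (b ∷ []) ρ))

coeff-alternatingSum : ∀ w a u v →
  coeff w (alternatingSum (a ∷ u) v) ≡ - coeff w (leading (bullets (a ∷ u)) v)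
coeff-alternatingSum w a u [] = begin
  coeff w (scale (- 1ℚ) (bullets (a ∷ u) ⊛ []) ++ [])
    ≡⟨ cong (coeff w) (List.++-identityʳ (scale (- 1ℚ) (bullets (a ∷ u) ⊛ []))) ⟩
  coeff w (scale (- 1ℚ) (bullets (a ∷ u) ⊛ []))
    ≡⟨ coeff-scale-neg w 1ℚ (bullets (a ∷ u) ⊛ []) ⟩
  - coeff w (scale 1ℚ (bullets (a ∷ u) ⊛ []))
    ≡⟨ cong -_ (scale-identityˡ (bullets (a ∷ u) ⊛ []) .coeff-≡ w) ⟩
  - coeff w (bullets (a ∷ u) ⊛ [])
    ≡⟨ cong (-_ ∘ coeff w) (⊛-[] (bullets-nonEmpty a u)) ⟩
  - coeff w (leading (bullets (a ∷ u)) []) ∎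
  where open ≡-Reasoning
coeff-alternatingSum w a u (b ∷ v) = begin
  coeff w (alternatingSum ρ (b ∷ v))
    ≡⟨ cong (coeff w) (concatMap-upTo-suc (alternatingTerm ρ (b ∷ v)) (suc (length v))) ⟩
  coeff w (alternatingTerm ρ (b ∷ v) 0 ++ concatMap (alternatingTerm ρ (b ∷ v) ∘ suc) (upTo (suc (length v))))
    ≡⟨ coeff-++ w (alternatingTerm ρ (b ∷ v) 0) _ ⟩
  coeff w (scale (- 1ℚ) (X ⊛ (b ∷ v))) + coeff w (concatMap (alternatingTerm ρ (b ∷ v) ∘ suc) (upTo (suc (length v))))
    ≡⟨ cong₂ _+_ (trans (coeff-scale-neg w 1ℚ (X ⊛ (b ∷ v))) (cong -_ (scale-identityˡ (X ⊛ (b ∷ v)) .coeff-≡ w)))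
                 (trans (cong (coeff w) (List.concatMap-cong (alternatingTerm-suc ρ b v) (upTo (suc (length v)))))
                        (coeff-concatMap-neg w (sign ∘ suc) (λ j → bullets (reverse (take j v) ++ b ∷ ρ) ⊛ drop j v)
                          (upTo (suc (length v))))) ⟩
  - coeff w (X ⊛ (b ∷ v)) + - coeff w (alternatingSum (b ∷ ρ) v)
    ≡⟨ cong₂ (λ p q → - p + - q)
         (trans (⊛-∷ (bullets-nonEmpty a u) b v .coeff-≡ w) (coeff-++ w (leading X (b ∷ v)) (leading X′ v)))
         (trans (coeff-alternatingSum w b ρ v) (cong (λ Y → - coeff w (leading Y v)) (bullets-∷ b a u))) ⟩
  - (coeff w (leading X (b ∷ v)) + coeff w (leading X′ v)) + - - coeff w (leading X′ v)
    ≡⟨ cong (_+ - - coeff w (leading X′ v)) (ℚ.neg-distrib-+ (coeff w (leading X (b ∷ v))) (coeff w (leading X′ v))) ⟩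
  (- coeff w (leading X (b ∷ v)) + - coeff w (leading X′ v)) + - - coeff w (leading X′ v)
    ≡⟨ //-rightDividesʳ (- coeff w (leading X′ v)) (- coeff w (leading X (b ∷ v))) ⟩
  - coeff w (leading X (b ∷ v)) ∎
  where
  open ≡-Reasoning
  ρ = a ∷ u
  X = bullets ρ
  X′ = concatMap (extend b) X

term≈alternatingTerm : ∀ u v j →
  scale (sign (suc j)) (term (u ∷ v) (suc j)) ≈ alternatingTerm (u ∷ []) v j
term≈alternatingTerm u v j = scale-cong (sign (suc j))
  (≈-trans (*-word≈⊛ (bullets (reverse (u ∷ take j v))) (drop j v))
           (≡⇒≈ (cong (λ σ → bullets σ ⊛ drop j v) (List.unfold-reverse u (take j v)))))

corollary1p9 : (us : List Letter) → 1 ≤ length us →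
    (w : Word) → coeff w (lhs us) ≡ 0ℚ
corollary1p9 [] () w
corollary1p9 (u ∷ v) _ w = begin
  coeff w (lhs (u ∷ v))
    ≡⟨ coeff-++ w ((1ℚ , u ∷ v) ∷ []) terms ⟩
  coeff w ((1ℚ , u ∷ v) ∷ []) + coeff w terms
    ≡⟨ cong (coeff w ((1ℚ , u ∷ v) ∷ []) +_)
         (trans (concatMap-cong-≈ (term≈alternatingTerm u v) (upTo (length (u ∷ v))) .coeff-≡ w)
                (coeff-alternatingSum w u [] v)) ⟩
  coeff w ((1ℚ , u ∷ v) ∷ []) + - coeff w ((1ℚ , u ∷ v) ∷ [])
    ≡⟨ ℚ.+-inverseʳ (coeff w ((1ℚ , u ∷ v) ∷ [])) ⟩
  0ℚ ∎
  where
  open ≡-Reasoning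
  terms = concatMap (λ j → scale (sign (suc j)) (term (u ∷ v) (suc j))) (upTo (length (u ∷ v)))
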